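{- Let $R$ be a finite local ring (associative, with unity). Then: (1) no outlier of ${}^2\!R$ generates a free cyclic submodule of ${}^2\!R$; (2) $(a,b)\in{}^2\!R$ is an outlier if and only if $a\notin bR$ and $b\notin aR$.
   Context: A local ring is an associative ring with exactly one maximal left (equivalently, right) ideal. ${}^2\!R$ denotes the left $R$-module $R\times R$ with $\alpha(a,b)=(\alpha a,\alpha b)$; $R(a,b)=\{(\alpha a,\alpha b):\alpha\in R\}$ is a free cyclic submodule if $(\alpha a,\alpha b)=(0,0)$ implies $\alpha=0$. A vector $(c,d)$ is unimodular if $cR+dR=\{cx+dy:x,y\in R\}=R$. $(a,b)$ is an outlier if it is contained in no cyclic submodule $R(c,d)$ with $(c,d)$ unimodular, i.e. there do not exist $\alpha,c,d\in R$ with $(a,b)=(\alpha c,\alpha d)$ and $(c,d)$ unimodular. -}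

module Defs where

open import Level using (Level; _⊔_) renaming (suc to lsuc)
open import Algebra.Bundles using (Ring)
open import Data.Nat using (ℕ)
open import Data.Fin using (Fin)
open import Data.Product using (Σ; ∃; _×_; _,_)
open import Relation.Nullary using (¬_)

module _ {c ℓ : Level} (R : Ring c ℓ) where
  open Ring R

  Finite : Set (c ⊔ ℓ)
  Finite = Σ ℕ λ n → Σ (Fin n → Carrier) λ f → ∀ x → ∃ λ i → f i ≈ x

  record LeftIdeal : Set (lsuc (c ⊔ ℓ)) where
    field
      member  : Carrier → Set (c ⊔ ℓ)
      resp    : ∀ {x y} → x ≈ y → member x → member y
      has-0   : member 0#
      closed+ : ∀ {x y} → member x → member y → member (x + y)
      closed* : ∀ r {x} → member x → member (r * x)

  open LeftIdeal

  _⊆ᴵ_ : LeftIdeal → LeftIdeal → Set (c ⊔ ℓ)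
  I ⊆ᴵ J = ∀ x → member I x → member J x

  Proper : LeftIdeal → Set (c ⊔ ℓ)
  Proper I = ¬ member I 1#

  MaximalLeftIdeal : LeftIdeal → Set (lsuc (c ⊔ ℓ))
  MaximalLeftIdeal I = Proper I × (∀ J → Proper J → I ⊆ᴵ J → J ⊆ᴵ I)

  IsLocal : Set (lsuc (c ⊔ ℓ))
  IsLocal = Σ LeftIdeal λ M → MaximalLeftIdeal M
              × (∀ N → MaximalLeftIdeal N → (N ⊆ᴵ M) × (M ⊆ᴵ N))

  Unimodular : Carrier → Carrier → Set (c ⊔ ℓ)
  Unimodular u v = ∀ r → ∃ λ x → ∃ λ y → u * x + v * y ≈ r

  Outlier : Carrier → Carrier → Set (c ⊔ ℓ)
  Outlier a b = ¬ (∃ λ α → ∃ λ u → ∃ λ v → (a ≈ α * u) × (b ≈ α * v) × Unimodular u v)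

  GeneratesFree : Carrier → Carrier → Set (c ⊔ ℓ)
  GeneratesFree a b = ∀ α → α * a ≈ 0# → α * b ≈ 0# → α ≈ 0#

  _∈_R : Carrier → Carrier → Set (c ⊔ ℓ)
  a ∈ b R = ∃ λ x → a ≈ b * x

module Submission where

-- Every assertion of the theorem is a negation, so the proof may argue by
-- cases inside double negations; no decidable equality on R is needed.
--
-- 1. In a finite ring every proper left ideal extends to a maximal one:
--    run through an enumeration of R, adjoining each element whenever the
--    result stays proper.  In a local ring M therefore contains every proper
--    left ideal, in particular R·z for every non-left-invertible z.
-- 2. For a proper left ideal M containing all proper left ideals, elements
--    outside M have left and right inverses, right-invertible elements lie
--    outside M, and M is closed under right multiplication.
-- 3. With R finite of size n, M is nilpotent: a product of n elements of M
--    vanishes, by pigeonhole on its n+1 partial products.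
-- 4. Part (2): a ∈ bR or b ∈ aR exhibits (a,b) = α(u,v) with (u,v) unimodular;
--    conversely a unimodular (u,v) has an entry outside M, i.e. a unit.
-- 5. Part (1): the entries a, b of an outlier lie in M.  If R(a,b) were free,
--    freeness turns vanishing of the products w·a and w·b into vanishing of w,
--    so by descending induction from words of length n (nilpotence) the empty
--    word vanishes, i.e. 1 = 0.

open import Defs
open import Algebra.Bundles using (Ring)
open import Data.Product using (_×_)
open import Function.Bundles using (_⇔_)
open import Relation.Nullary using (¬_)

open import Level using (_⊔_)
open import Data.Product using (Σ; ∃; _,_; proj₁; proj₂)
open import Data.Empty using (⊥; ⊥-elim)
open import Data.Nat as ℕ using (ℕ; zero; suc; s≤s)
import Data.Nat.Properties as ℕₚ
open import Data.Fin using (Fin; toℕ) renaming (zero to fzero; suc to fsuc)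
open import Data.Fin.Properties using (pigeonhole; toℕ≤pred[n])
open import Data.List using (List; []; _∷_; take; length)
open import Data.List.Properties using (take-all)
open import Data.List.Relation.Unary.All using (All; []; _∷_)
open import Relation.Nullary.Decidable.Core using (yes; no; ¬¬-excluded-middle)
import Relation.Binary.PropositionalEquality as ≡
open import Function.Bundles using (mk⇔)
open import Function.Base using (_∘_)

module _ {c ℓ} (R : Ring c ℓ) where
  open Ring R
  open LeftIdeal
  open import Relation.Binary.Reasoning.Setoid setoid
  open import Algebra.Properties.Ring R using ([y-z]x≈yx-zx)

  infix 4 _⊆_ _∈_·R

  _⊆_ : LeftIdeal R → LeftIdeal R → Set (c ⊔ ℓ)
  _⊆_ = _⊆ᴵ_ R

  _∈_·R : Carrier → Carrier → Set (c ⊔ ℓ)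
  a ∈ b ·R = _∈_R R a b

  [1-y]x≈x-yx : ∀ y x → (1# - y) * x ≈ x - y * x
  [1-y]x≈x-yx y x = trans ([y-z]x≈yx-zx x 1# y) (+-congʳ (*-identityˡ x))

  1-y+y≈1 : ∀ y → (1# - y) + y ≈ 1#
  1-y+y≈1 y = trans (+-assoc 1# (- y) y) (trans (+-congˡ (-‿inverseˡ y)) (+-identityʳ 1#))

  x≈x+0g : ∀ x g → x ≈ x + 0# * g
  x≈x+0g x g = sym (trans (+-congˡ (zeroˡ g)) (+-identityʳ x))

  principal : Carrier → LeftIdeal R
  principal z = record
    { member  = λ x → ∃ λ r → x ≈ r * z
    ; resp    = λ { x≈y (r , x≈rz) → r , trans (sym x≈y) x≈rz }
    ; has-0   = 0# , sym (zeroˡ z)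
    ; closed+ = λ { (r , x≈rz) (s , y≈sz) →
                    r + s , trans (+-cong x≈rz y≈sz) (sym (distribʳ z r s)) }
    ; closed* = λ { t (r , x≈rz) → t * r , trans (*-congˡ x≈rz) (sym (*-assoc t r z)) }
    }

  adjoin : LeftIdeal R → Carrier → LeftIdeal R
  adjoin I g = record
    { member  = λ x → ∃ λ y → ∃ λ r → member I y × x ≈ y + r * g
    ; resp    = λ { x≈x' (y , r , y∈I , x≈) → y , r , y∈I , trans (sym x≈x') x≈ }
    ; has-0   = 0# , 0# , has-0 I , x≈x+0g 0# g
    ; closed+ = λ { (y , r , y∈I , x≈) (y' , r' , y'∈I , x'≈) →
                    y + y' , r + r' , closed+ I y∈I y'∈I ,
                    (begin
                      _ + _                        ≈⟨ +-cong x≈ x'≈ ⟩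
                      (y + r * g) + (y' + r' * g)  ≈⟨ interchange y (r * g) y' (r' * g) ⟩
                      (y + y') + (r * g + r' * g)  ≈⟨ +-congˡ (distribʳ g r r') ⟨
                      (y + y') + (r + r') * g      ∎) }
    ; closed* = λ { t (y , r , y∈I , x≈) →
                    t * y , t * r , closed* I t y∈I ,
                    (begin
                      t * _                ≈⟨ *-congˡ x≈ ⟩
                      t * (y + r * g)      ≈⟨ distribˡ t y (r * g) ⟩
                      t * y + t * (r * g)  ≈⟨ +-congˡ (*-assoc t r g) ⟨
                      t * y + t * r * g    ∎) }
    }
    where
      open import Algebra.Properties.CommutativeSemigroup +-commutativeSemigroup
        using (interchange)

  adjoin-⊇ : ∀ I g → I ⊆ adjoin I g
  adjoin-⊇ I g x x∈I = x , 0# , x∈I , x≈x+0g x g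

  adjoin-∋ : ∀ I g → member (adjoin I g) g
  adjoin-∋ I g = 0# , 1# , has-0 I , sym (trans (+-identityˡ (1# * g)) (*-identityˡ g))

  adjoin-least : ∀ {I J g} → I ⊆ J → member J g → adjoin I g ⊆ J
  adjoin-least {J = J} {g} I⊆J g∈J x (y , r , y∈I , x≈) =
    resp J (sym x≈) (closed+ J (I⊆J y y∈I) (closed* J r g∈J))

  -- One greedy step: adjoin g to I if I + R·g is still proper, else keep I.
  -- The case distinction is encoded by two implications, so it needs no decision.
  greedyStep : LeftIdeal R → Carrier → LeftIdeal R
  greedyStep I g = record
    { member  = λ x → (Proper R S → member S x) × (¬ Proper R S → member I x)
    ; resp    = λ { x≈y (inS , inI) → resp S x≈y ∘ inS , resp I x≈y ∘ inI }
    ; has-0   = (λ _ → has-0 S) , (λ _ → has-0 I)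
    ; closed+ = λ { (inS , inI) (inS' , inI') →
                    (λ p → closed+ S (inS p) (inS' p)) , (λ p → closed+ I (inI p) (inI' p)) }
    ; closed* = λ { t (inS , inI) → closed* S t ∘ inS , closed* I t ∘ inI }
    }
    where S = adjoin I g

  greedyStep-⊇ : ∀ I g → I ⊆ greedyStep I g
  greedyStep-⊇ I g x x∈I = (λ _ → adjoin-⊇ I g x x∈I) , (λ _ → x∈I)

  -- If I + R·g were improper, the second component would put 1 in I.
  greedyStep-proper : ∀ I g → Proper R I → Proper R (greedyStep I g)
  greedyStep-proper I g I-proper (inS , inI) = I-proper (inI (λ S-proper → S-proper (inS S-proper)))

  greedyStep-∋ : ∀ I g → Proper R (adjoin I g) → member (greedyStep I g) g
  greedyStep-∋ I g S-proper = (λ _ → adjoin-∋ I g) , (λ S-improper → ⊥-elim (S-improper S-proper))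

  greedy : (n : ℕ) → (Fin n → Carrier) → LeftIdeal R → LeftIdeal R
  greedy zero    f I = I
  greedy (suc n) f I = greedy n (f ∘ fsuc) (greedyStep I (f fzero))

  greedy-⊇ : ∀ n f I → I ⊆ greedy n f I
  greedy-⊇ zero    f I x x∈I = x∈I
  greedy-⊇ (suc n) f I x x∈I =
    greedy-⊇ n (f ∘ fsuc) (greedyStep I (f fzero)) x (greedyStep-⊇ I (f fzero) x x∈I)

  greedy-proper : ∀ n f I → Proper R I → Proper R (greedy n f I)
  greedy-proper zero    f I I-proper = I-proper
  greedy-proper (suc n) f I I-proper =
    greedy-proper n (f ∘ fsuc) (greedyStep I (f fzero)) (greedyStep-proper I (f fzero) I-proper)

  -- Saturation: an enumerated element lying in some proper J ⊇ greedy n f I was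
  -- already adjoined, since at its step the adjunction stayed inside J.
  greedy-saturated : ∀ n f I J → Proper R J → greedy n f I ⊆ J →
                     ∀ i → member J (f i) → member (greedy n f I) (f i)
  greedy-saturated (suc n) f I J J-proper N⊆J fzero f₀∈J =
    greedy-⊇ n (f ∘ fsuc) _ (f fzero) (greedyStep-∋ I (f fzero) S-proper)
    where
      I⊆J : I ⊆ J
      I⊆J x x∈I = N⊆J x (greedy-⊇ (suc n) f I x x∈I)
      S-proper : Proper R (adjoin I (f fzero))
      S-proper 1∈S = J-proper (adjoin-least {I} {J} I⊆J f₀∈J 1# 1∈S)
  greedy-saturated (suc n) f I J J-proper N⊆J (fsuc i) fᵢ∈J =
    greedy-saturated n (f ∘ fsuc) (greedyStep I (f fzero)) J J-proper N⊆J i fᵢ∈J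

  extendToMaximal : Finite R → ∀ I → Proper R I →
                    Σ (LeftIdeal R) λ N → MaximalLeftIdeal R N × I ⊆ N
  extendToMaximal (n , f , onto) I I-proper =
    N , (greedy-proper n f I I-proper , maximal) , greedy-⊇ n f I
    where
      N = greedy n f I
      maximal : ∀ J → Proper R J → N ⊆ J → J ⊆ N
      maximal J J-proper N⊆J x x∈J =
        let (i , fᵢ≈x) = onto x
        in resp N fᵢ≈x (greedy-saturated n f I J J-proper N⊆J i (resp J (sym fᵢ≈x) x∈J))

  local-largest : Finite R → (loc : IsLocal R) → ∀ I → Proper R I → I ⊆ proj₁ loc
  local-largest fin (M , _ , unique) I I-proper x x∈I =
    let (N , N-maximal , I⊆N) = extendToMaximal fin I I-proper
    in proj₁ (unique N N-maximal) x (I⊆N x x∈I)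

  -- revProd [x₁, …, xₖ] = xₖ ⋯ x₁: prepending a letter multiplies on the right.
  revProd : List Carrier → Carrier
  revProd []      = 1#
  revProd (x ∷ w) = revProd w * x

  prefix-factor : ∀ (I : LeftIdeal R) w → All (member I) w → ∀ i j → i ℕ.< j → j ℕ.≤ length w →
                  ∃ λ y → member I y × revProd (take j w) ≈ y * revProd (take i w)
  prefix-factor I (x ∷ w) (x∈I ∷ w⊆I) zero (suc j) _ _ =
    revProd (take j w) * x , closed* I (revProd (take j w)) x∈I , sym (*-identityʳ _)
  prefix-factor I (x ∷ w) (x∈I ∷ w⊆I) (suc i) (suc j) (s≤s i<j) (s≤s j≤|w|) =
    let (y , y∈I , eq) = prefix-factor I w w⊆I i j i<j j≤|w|
    in y , y∈I , trans (*-congʳ eq) (*-assoc y _ x)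

  finite-pigeonhole : (fin : Finite R) (P : ℕ → Carrier) →
                      ∃ λ i → ∃ λ j → i ℕ.< j × j ℕ.≤ proj₁ fin × P i ≈ P j
  finite-pigeonhole (n , f , onto) P =
    let (i , j , i<j , same) = pigeonhole (ℕₚ.n<1+n n) index
    in toℕ i , toℕ j , i<j , toℕ≤pred[n] j ,
       (begin
         P (toℕ i)      ≈⟨ proj₂ (onto (P (toℕ i))) ⟨
         f (index i)    ≡⟨ ≡.cong f same ⟩
         f (index j)    ≈⟨ proj₂ (onto (P (toℕ j))) ⟩
         P (toℕ j)      ∎)
    where
      index : Fin (suc n) → Fin n
      index k = proj₁ (onto (P (toℕ k)))

  unimodular-1ˡ : ∀ v → Unimodular R 1# v
  unimodular-1ˡ v r = r , 0# , trans (+-cong (*-identityˡ r) (zeroʳ v)) (+-identityʳ r)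

  unimodular-1ʳ : ∀ u → Unimodular R u 1#
  unimodular-1ʳ u r = 0# , r , trans (+-cong (zeroʳ u) (*-identityˡ r)) (+-identityˡ r)

  -- If a = b x then (a,b) = b (x,1) lies in a unimodular cyclic submodule;
  -- symmetrically if b = a x.  This is the easy half of part (2).
  outlier⇒¬divides : ∀ {a b} → Outlier R a b → ¬ a ∈ b ·R × ¬ b ∈ a ·R
  outlier⇒¬divides {a} {b} out =
    (λ (x , a≈bx) → out (b , x , 1# , a≈bx , sym (*-identityʳ b) , unimodular-1ʳ x)) ,
    (λ (x , b≈ax) → out (a , 1# , x , sym (*-identityʳ a) , b≈ax , unimodular-1ˡ x))

  rightUnit⇒divides : ∀ {a b α u v u'} → u * u' ≈ 1# → a ≈ α * u → b ≈ α * v → b ∈ a ·R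
  rightUnit⇒divides {a} {b} {α} {u} {v} {u'} uu'≈1 a≈αu b≈αv = u' * v , (begin
    b                   ≈⟨ b≈αv ⟩
    α * v               ≈⟨ *-congˡ (*-identityˡ v) ⟨
    α * (1# * v)        ≈⟨ *-congˡ (*-congʳ uu'≈1) ⟨
    α * (u * u' * v)    ≈⟨ *-congˡ (*-assoc u u' v) ⟩
    α * (u * (u' * v))  ≈⟨ *-assoc α u (u' * v) ⟨
    α * u * (u' * v)    ≈⟨ *-congʳ a≈αu ⟨
    a * (u' * v)        ∎)

  -- Facts about a proper left ideal M containing every proper left ideal
  -- (the maximal ideal of a finite local ring): M is the set of non-units.
  module LargestProperIdeal (M : LeftIdeal R) (M-proper : Proper R M)
                            (M-largest : ∀ I → Proper R I → I ⊆ M) where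

    ≈1⇒∉M : ∀ {x} → x ≈ 1# → ¬ member M x
    ≈1⇒∉M x≈1 x∈M = M-proper (resp M x≈1 x∈M)

    1-y∉M : ∀ {y} → member M y → ¬ member M (1# - y)
    1-y∉M {y} y∈M 1-y∈M = ≈1⇒∉M (1-y+y≈1 y) (closed+ M 1-y∈M y∈M)

    -- If z ∉ M, then R·z is improper, i.e. z has a left inverse.
    leftInverse : ∀ z → ¬ member M z → ¬ ¬ (∃ λ t → t * z ≈ 1#)
    leftInverse z z∉M no-inverse = z∉M (M-largest (principal z) Rz-proper z (1# , sym (*-identityˡ z)))
      where
        Rz-proper : Proper R (principal z)
        Rz-proper (t , 1≈tz) = no-inverse (t , sym 1≈tz)

    -- A left inverse t of z ∉ M is a two-sided inverse: if t ∉ M it has a left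
    -- inverse s = z; if t ∈ M, then 1 - zt ∉ M has a left inverse, which
    -- annihilates (1 - zt) z = 0 and forces z = 0.
    rightInverse : ∀ z → ¬ member M z → ¬ ¬ (∃ λ t → z * t ≈ 1#)
    rightInverse z z∉M no-inverse = leftInverse z z∉M λ (t , tz≈1) →
      ¬¬-excluded-middle λ
        { (no t∉M)  → leftInverse t t∉M λ (s , st≈1) →
            no-inverse (t , trans (*-congʳ (z≈s s t st≈1 tz≈1)) st≈1)
        ; (yes t∈M) → leftInverse (1# - z * t) (1-y∉M (closed* M z t∈M)) λ (s , s[1-zt]≈1) →
            ≈1⇒∉M (begin
              0#       ≈⟨ zeroʳ t ⟨
              t * 0#   ≈⟨ *-congˡ (z≈0 t tz≈1 s s[1-zt]≈1) ⟨
              t * z    ≈⟨ tz≈1 ⟩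
              1#       ∎) (has-0 M) }
      where
        z≈s : ∀ s t → s * t ≈ 1# → t * z ≈ 1# → z ≈ s
        z≈s s t st≈1 tz≈1 = begin
          z            ≈⟨ *-identityˡ z ⟨
          1# * z       ≈⟨ *-congʳ st≈1 ⟨
          s * t * z    ≈⟨ *-assoc s t z ⟩
          s * (t * z)  ≈⟨ *-congˡ tz≈1 ⟩
          s * 1#       ≈⟨ *-identityʳ s ⟩
          s            ∎
        z≈0 : ∀ t → t * z ≈ 1# → ∀ s → s * (1# - z * t) ≈ 1# → z ≈ 0#
        z≈0 t tz≈1 s s[1-zt]≈1 = begin
          z                        ≈⟨ *-identityˡ z ⟨
          1# * z                   ≈⟨ *-congʳ s[1-zt]≈1 ⟨
          s * (1# - z * t) * z     ≈⟨ *-assoc s _ z ⟩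
          s * ((1# - z * t) * z)   ≈⟨ *-congˡ ([1-y]x≈x-yx (z * t) z) ⟩
          s * (z - z * t * z)      ≈⟨ *-congˡ (+-congˡ (-‿cong ztz≈z)) ⟩
          s * (z - z)              ≈⟨ *-congˡ (-‿inverseʳ z) ⟩
          s * 0#                   ≈⟨ zeroʳ s ⟩
          0#                       ∎
          where
            ztz≈z : z * t * z ≈ z
            ztz≈z = trans (*-assoc z t z) (trans (*-congˡ tz≈1) (*-identityʳ z))

    -- Right-invertible elements lie outside M: if u ∈ M and u w = 1, then
    -- w ∉ M has a right inverse w' = u, so 1 = w u ∈ M.
    rightInvertible⇒∉M : ∀ {u w} → u * w ≈ 1# → ¬ member M u
    rightInvertible⇒∉M {u} {w} uw≈1 u∈M =
      rightInverse w (λ w∈M → ≈1⇒∉M uw≈1 (closed* M u w∈M)) λ (w' , ww'≈1) →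
        ≈1⇒∉M (trans (*-congˡ (u≈w' w' ww'≈1)) ww'≈1) (closed* M w u∈M)
      where
        u≈w' : ∀ w' → w * w' ≈ 1# → u ≈ w'
        u≈w' w' ww'≈1 = begin
          u             ≈⟨ *-identityʳ u ⟨
          u * 1#        ≈⟨ *-congˡ ww'≈1 ⟨
          u * (w * w')  ≈⟨ *-assoc u w w' ⟨
          u * w * w'    ≈⟨ *-congʳ uw≈1 ⟩
          1# * w'       ≈⟨ *-identityˡ w' ⟩
          w'            ∎

    M-closedʳ : ∀ {u} → member M u → ∀ x → ¬ ¬ member M (u * x)
    M-closedʳ {u} u∈M x ux∉M = rightInverse (u * x) ux∉M λ (s , uxs≈1) →
      rightInvertible⇒∉M (trans (sym (*-assoc u x s)) uxs≈1) u∈M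

    ∉M⇒divides : ∀ {a} → ¬ member M a → ∀ b → ¬ ¬ (b ∈ a ·R)
    ∉M⇒divides {a} a∉M b no-divisor = rightInverse a a∉M λ (r , ar≈1) →
      no-divisor (r * b , (begin
        b             ≈⟨ *-identityˡ b ⟨
        1# * b        ≈⟨ *-congʳ ar≈1 ⟨
        a * r * b     ≈⟨ *-assoc a r b ⟩
        a * (r * b)   ∎))

    -- In a unimodular pair (u,v), not both entries lie in M: else ux + vy = 1 ∈ M.
    unimodular⇒¬bothInM : ∀ {u v} → Unimodular R u v → member M u → member M v → ⊥
    unimodular⇒¬bothInM unimodular u∈M v∈M =
      let (x , y , ux+vy≈1) = unimodular 1#
      in M-closedʳ u∈M x λ ux∈M → M-closedʳ v∈M y λ vy∈M →
           ≈1⇒∉M ux+vy≈1 (closed+ M ux∈M vy∈M)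

    -- Part (2) of the theorem.  Conversely to outlier⇒¬divides, if (a,b) = α(u,v)
    -- with (u,v) unimodular then u or v is outside M, hence right invertible.
    outlier⇔ : ∀ a b → Outlier R a b ⇔ (¬ a ∈ b ·R × ¬ b ∈ a ·R)
    outlier⇔ a b = mk⇔ outlier⇒¬divides from
      where
        from : ¬ a ∈ b ·R × ¬ b ∈ a ·R → Outlier R a b
        from (a∉bR , b∉aR) (α , u , v , a≈αu , b≈αv , unimodular) =
          ¬¬-excluded-middle λ
            { (no u∉M)  → rightInverse u u∉M λ (_ , uu'≈1) →
                b∉aR (rightUnit⇒divides uu'≈1 a≈αu b≈αv)
            ; (yes u∈M) → ¬¬-excluded-middle λ
              { (no v∉M)  → rightInverse v v∉M λ (_ , vv'≈1) →
                  a∉bR (rightUnit⇒divides vv'≈1 b≈αv a≈αu)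
              ; (yes v∈M) → unimodular⇒¬bothInM unimodular u∈M v∈M } }

    -- If p = y p with y ∈ M, then p = 0, since 1 - y ∉ M is left invertible.
    fixed-by-M⇒0 : ∀ {y p} → member M y → p ≈ y * p → ¬ ¬ (p ≈ 0#)
    fixed-by-M⇒0 {y} {p} y∈M p≈yp p≉0 = leftInverse (1# - y) (1-y∉M y∈M) λ (r , r[1-y]≈1) →
      p≉0 (begin
        p                  ≈⟨ *-identityˡ p ⟨
        1# * p             ≈⟨ *-congʳ r[1-y]≈1 ⟨
        r * (1# - y) * p   ≈⟨ *-assoc r _ p ⟩
        r * ((1# - y) * p) ≈⟨ *-congˡ ([1-y]x≈x-yx y p) ⟩
        r * (p - y * p)    ≈⟨ *-congˡ (+-congˡ (-‿cong p≈yp)) ⟨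
        r * (p - p)        ≈⟨ *-congˡ (-‿inverseʳ p) ⟩
        r * 0#             ≈⟨ zeroʳ r ⟩
        0#                 ∎)

    module Finiteness (fin : Finite R) where

      n : ℕ
      n = proj₁ fin

      -- M is nilpotent: two of the partial products P₀, …, Pₙ of w coincide,
      -- Pᵢ = Pⱼ = y Pᵢ with y ∈ M, so Pᵢ = 0 and hence the whole product vanishes.
      nilpotent : ∀ w → All (member M) w → n ℕ.≤ length w → ¬ ¬ (revProd w ≈ 0#)
      nilpotent w w⊆M n≤|w| w≉0 =
        let P : ℕ → Carrier
            P k = revProd (take k w)
            (i , j , i<j , j≤n , Pᵢ≈Pⱼ) = finite-pigeonhole fin P
            j≤|w| = ℕₚ.≤-trans j≤n n≤|w|
            (y , y∈M , Pⱼ≈yPᵢ) = prefix-factor M w w⊆M i j i<j j≤|w|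
            (y' , _ , P|w|≈y'Pᵢ) =
              prefix-factor M w w⊆M i (length w) (ℕₚ.<-≤-trans i<j j≤|w|) ℕₚ.≤-refl
        in fixed-by-M⇒0 y∈M (trans Pᵢ≈Pⱼ Pⱼ≈yPᵢ) λ Pᵢ≈0 → w≉0 (begin
             revProd w                    ≡⟨ ≡.cong revProd (take-all (length w) w ℕₚ.≤-refl) ⟨
             revProd (take (length w) w)  ≈⟨ P|w|≈y'Pᵢ ⟩
             y' * P i                     ≈⟨ *-congˡ Pᵢ≈0 ⟩
             y' * 0#                      ≈⟨ zeroʳ y' ⟩
             0#                           ∎)

      -- Induction on d: revProd w annihilates a and b,
      -- since (revProd w) a = revProd (a ∷ w) and (revProd w) b = revProd (b ∷ w).
      free⇒words-vanish : ∀ {a b} → member M a → member M b → GeneratesFree R a b →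
                          ∀ d w → All (member M) w → n ℕ.≤ length w ℕ.+ d →
                          ¬ ¬ (revProd w ≈ 0#)
      free⇒words-vanish _ _ _ zero w w⊆M n≤|w|+0 =
        nilpotent w w⊆M (ℕₚ.≤-trans n≤|w|+0 (ℕₚ.≤-reflexive (ℕₚ.+-identityʳ (length w))))
      free⇒words-vanish {a} {b} a∈M b∈M free (suc d) w w⊆M n≤|w|+1+d w≉0 =
        free⇒words-vanish a∈M b∈M free d (a ∷ w) (a∈M ∷ w⊆M) n≤|w|+1+d' λ wa≈0 →
        free⇒words-vanish a∈M b∈M free d (b ∷ w) (b∈M ∷ w⊆M) n≤|w|+1+d' λ wb≈0 →
        w≉0 (free (revProd w) wa≈0 wb≈0)
        where
          n≤|w|+1+d' : n ℕ.≤ suc (length w) ℕ.+ d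
          n≤|w|+1+d' = ℕₚ.≤-trans n≤|w|+1+d (ℕₚ.≤-reflexive (ℕₚ.+-suc (length w) d))

      -- Part (1) of the theorem: the entries of an outlier lie in M (a unit
      -- entry divides the other), and with d = n, w = [] freeness would give 1 = 0.
      outlier⇒¬free : ∀ a b → Outlier R a b → ¬ GeneratesFree R a b
      outlier⇒¬free a b out free =
        ¬¬-excluded-middle λ
          { (no a∉M)  → ∉M⇒divides a∉M b (proj₂ (outlier⇒¬divides out))
          ; (yes a∈M) → ¬¬-excluded-middle λ
            { (no b∉M)  → ∉M⇒divides b∉M a (proj₁ (outlier⇒¬divides out))
            ; (yes b∈M) → free⇒words-vanish a∈M b∈M free n [] [] ℕₚ.≤-refl λ 1≈0 →
                ≈1⇒∉M (sym 1≈0) (has-0 M) } }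

mainTheorem5 : ∀ {c ℓ} (R : Ring c ℓ) → Finite R → IsLocal R →
    (∀ a b → Outlier R a b → ¬ GeneratesFree R a b)
    × (∀ a b → Outlier R a b ⇔ (¬ _∈_R R a b × ¬ _∈_R R b a))
mainTheorem5 R fin loc@(M , (M-proper , _) , _) = outlier⇒¬free , outlier⇔
  where open LargestProperIdeal R M M-proper (local-largest R fin loc)
        open Finiteness fin
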